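{- Let $a,k\in\mathbb Z$. Then $\mathbf Z_a\ltimes\mathbf Z_k\cong\mathbf Z_a\ltimes\mathbf Z_{k+a}$ as pointed Abelian $\ell$-groups.
   Context: $\mathbf Z_n$ denotes the ordered additive group of integers with a constant $\mathtt f$ interpreted as $n$. $\mathbf Z_a\ltimes\mathbf Z_k$ is the group $\mathbb Z\times\mathbb Z$ with lexicographic order ($\langle x_1,y_1\rangle\le\langle x_2,y_2\rangle$ iff $x_1<x_2$, or $x_1=x_2$ and $y_1\le y_2$) and constant $\mathtt f=\langle a,k\rangle$. -}

module Defs where

open import Data.Integer using (ℤ; _+_; _≤_; _<_)
open import Data.Product using (_×_; _,_)
open import Data.Sum using (_⊎_)
open import Relation.Binary.PropositionalEquality using (_≡_)

ZZ : Set
ZZ = ℤ × ℤ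

_⊕_ : ZZ → ZZ → ZZ
(x₁ , y₁) ⊕ (x₂ , y₂) = (x₁ + x₂ , y₁ + y₂)

_≤lex_ : ZZ → ZZ → Set
(x₁ , y₁) ≤lex (x₂ , y₂) = (x₁ < x₂) ⊎ ((x₁ ≡ x₂) × (y₁ ≤ y₂))

-- The pointed abelian ℓ-group Z_a ⋉ Z_k is (ZZ, _⊕_, _≤lex_, f = ⟨a,k⟩).
-- An isomorphism of pointed abelian ℓ-groups Z_a ⋉ Z_k → Z_b ⋉ Z_m:
-- a bijective group homomorphism which preserves and reflects the order
-- (hence preserves the lattice operations) and sends ⟨a,k⟩ to ⟨b,m⟩.
record PointedLexIso (a k b m : ℤ) : Set where
  field
    to        : ZZ → ZZ
    from      : ZZ → ZZ
    from-to   : ∀ u → from (to u) ≡ u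
    to-from   : ∀ v → to (from v) ≡ v
    to-hom    : ∀ u v → to (u ⊕ v) ≡ to u ⊕ to v
    to-mono   : ∀ u v → u ≤lex v → to u ≤lex to v
    to-reflect : ∀ u v → to u ≤lex to v → u ≤lex v
    to-point  : to (a , k) ≡ (b , m)

-- The shear ⟨x,y⟩ ↦ ⟨x,y+x⟩ is an automorphism of the group ℤ × ℤ that sends ⟨a,k⟩ to
-- ⟨a,k+a⟩. It fixes first coordinates and translates each fibre {x} × ℤ by x, so it
-- respects the lexicographic order, which compares second coordinates only within a fibre.
module Submission where

open import Defs
open import Data.Integer using (ℤ; _+_; -_; _≤_)
open import Data.Integer.Properties using (+-monoˡ-≤)
open import Data.Integer.Tactic.RingSolver using (solve-∀)
open import Data.Product using (_,_)
open import Data.Sum using (inj₁; inj₂)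
open import Relation.Binary.PropositionalEquality using (_≡_; refl; cong; subst₂)

+-cancelʳ-≤ : ∀ {i j} k → i + k ≤ j + k → i ≤ j
+-cancelʳ-≤ {i} {j} k i+k≤j+k =
  subst₂ _≤_ (m+n+-n≡m i k) (m+n+-n≡m j k) (+-monoˡ-≤ (- k) i+k≤j+k)
  where
  m+n+-n≡m : ∀ m n → m + n + - n ≡ m
  m+n+-n≡m = solve-∀

translateFibres : (ℤ → ℤ) → ZZ → ZZ
translateFibres t (x , y) = (x , y + t x)

translateFibres-mono : ∀ t u v → u ≤lex v → translateFibres t u ≤lex translateFibres t v
translateFibres-mono t (x₁ , y₁) (x₂ , y₂) (inj₁ x₁<x₂)         = inj₁ x₁<x₂
translateFibres-mono t (x , y₁)  (.x , y₂) (inj₂ (refl , y₁≤y₂)) = inj₂ (refl , +-monoˡ-≤ (t x) y₁≤y₂)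

translateFibres-reflect : ∀ t u v → translateFibres t u ≤lex translateFibres t v → u ≤lex v
translateFibres-reflect t (x₁ , y₁) (x₂ , y₂) (inj₁ x₁<x₂)   = inj₁ x₁<x₂
translateFibres-reflect t (x , y₁)  (.x , y₂) (inj₂ (refl , p)) = inj₂ (refl , +-cancelʳ-≤ (t x) p)

shear : ZZ → ZZ
shear = translateFibres (λ x → x)

unshear : ZZ → ZZ
unshear = translateFibres (λ x → - x)

unshear-shear : ∀ u → unshear (shear u) ≡ u
unshear-shear (x , y) = cong (x ,_) (y+x-x≡y y x)
  where
  y+x-x≡y : ∀ y x → y + x + - x ≡ y
  y+x-x≡y = solve-∀

shear-unshear : ∀ u → shear (unshear u) ≡ u
shear-unshear (x , y) = cong (x ,_) (y-x+x≡y y x)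
  where
  y-x+x≡y : ∀ y x → y + - x + x ≡ y
  y-x+x≡y = solve-∀

shear-⊕ : ∀ u v → shear (u ⊕ v) ≡ shear u ⊕ shear v
shear-⊕ (x₁ , y₁) (x₂ , y₂) = cong ((x₁ + x₂) ,_) (interchange y₁ y₂ x₁ x₂)
  where
  interchange : ∀ y₁ y₂ x₁ x₂ → (y₁ + y₂) + (x₁ + x₂) ≡ (y₁ + x₁) + (y₂ + x₂)
  interchange = solve-∀

lemma4p4 : (a k : ℤ) → PointedLexIso a k a (k + a)
lemma4p4 a k = record
  { to         = shear
  ; from       = unshear
  ; from-to    = unshear-shear
  ; to-from    = shear-unshear
  ; to-hom     = shear-⊕
  ; to-mono    = translateFibres-mono (λ x → x)
  ; to-reflect = translateFibres-reflect (λ x → x)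
  ; to-point   = refl
  }
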